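{- Let $m\ge 2$, $s\ge 1$ and let $X_1,\dots,X_m\in\mathbb{Z}^s$ span $\mathbb{R}^s$ and satisfy $\langle X_j,\alpha\rangle>0$ for all $j$, for some $\alpha\in\mathbb{R}^s$. Let $\mathcal{J}=X_1\mathbb{N}+\dots+X_m\mathbb{N}$ and for $z\in\mathcal{J}$ let $A(z)=\{u\in\mathbb{N}^m:\sum_{j=1}^mu_jX_j=z\}\subset\mathbb{R}^m$. Let $C_0\ge1$ be an integer. Then there exists an integer $M>0$ such that $d_H(A(z),A(z'))<M$ whenever $z,z'\in\mathcal{J}$ and $\|z-z'\|\le C_0$.
   Context: $\mathbb{N}=\{0,1,2,\dots\}$, $\|\cdot\|$ is the Euclidean norm, and $d_H(A,B)=\max\{\sup_{a\in A}d(a,B),\sup_{b\in B}d(b,A)\}$ is the Hausdorff distance with respect to the Euclidean metric. -}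

module Defs where

open import Data.Nat using (ℕ; zero; suc)
open import Data.Fin using (Fin; zero; suc)
open import Data.Integer as ℤ using (ℤ; +_)
open import Data.Rational as ℚ using (ℚ; 0ℚ)
open import Data.Product using (Σ; ∃; _×_)
open import Relation.Binary.PropositionalEquality using (_≡_)

sumℤ : {n : ℕ} → (Fin n → ℤ) → ℤ
sumℤ {zero} f = + 0
sumℤ {suc n} f = f zero ℤ.+ sumℤ (λ i → f (suc i))

sumℚ : {n : ℕ} → (Fin n → ℚ) → ℚ
sumℚ {zero} f = 0ℚ
sumℚ {suc n} f = f zero ℚ.+ sumℚ (λ i → f (suc i))

toℚ : ℤ → ℚ
toℚ z = z ℚ./ 1

dotℤℚ : {s : ℕ} → (Fin s → ℤ) → (Fin s → ℚ) → ℚ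
dotℤℚ x a = sumℚ (λ i → toℚ (x i) ℚ.* a i)

-- X_1..X_m span Q^s (equivalently R^s, as the X_j are integral)
Spans : {m s : ℕ} → (Fin m → Fin s → ℤ) → Set
Spans {m} {s} X = (v : Fin s → ℚ) → Σ (Fin m → ℚ) λ c →
  (i : Fin s) → sumℚ (λ j → c j ℚ.* toℚ (X j i)) ≡ v i

combo : {m s : ℕ} → (Fin m → Fin s → ℤ) → (Fin m → ℕ) → Fin s → ℤ
combo X u i = sumℤ (λ j → + (u j) ℤ.* X j i)

InA : {m s : ℕ} → (Fin m → Fin s → ℤ) → (Fin s → ℤ) → (Fin m → ℕ) → Set
InA {m} {s} X z u = (i : Fin s) → combo X u i ≡ z i

InJ : {m s : ℕ} → (Fin m → Fin s → ℤ) → (Fin s → ℤ) → Set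
InJ {m} X z = Σ (Fin m → ℕ) λ u → InA X z u

normSq : {n : ℕ} → (Fin n → ℤ) → ℤ
normSq v = sumℤ (λ i → v i ℤ.* v i)

distSq : {m : ℕ} → (Fin m → ℕ) → (Fin m → ℕ) → ℤ
distSq u u' = normSq (λ j → + (u j) ℤ.- + (u' j))

-- d(a, B) < M for every a in A(z) (sets are finite, so sup/inf are attained)
HalfHausLt : {m s : ℕ} → (Fin m → Fin s → ℤ) → (Fin s → ℤ) → (Fin s → ℤ) → ℕ → Set
HalfHausLt {m} X z z' M = (u : Fin m → ℕ) → InA X z u →
  Σ (Fin m → ℕ) λ u' → InA X z' u' × (distSq u u' ℤ.< + (M Data.Nat.* M))

HausLt : {m s : ℕ} → (Fin m → Fin s → ℤ) → (Fin s → ℤ) → (Fin s → ℤ) → ℕ → Set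
HausLt X z z' M = HalfHausLt X z z' M × HalfHausLt X z' z M

module Submission where

-- For u ∈ A(z) and v ∈ A(z') the "bridge" list of signed generators
-- (v_j copies of +X_j and u_j copies of −X_j) has total z' − z.  Moving u along any
-- sub-multiset L of the bridge with the same total lands in A(z'), at distance at
-- most |L| from u.  It therefore suffices to shorten the bridge, which a zero-sum
-- lemma does: every long enough list of vectors with bounded entries and bounded
-- total has a nonempty zero-sum sub-multiset, and removing it keeps the total.

open import Defs
open import Data.Nat using (ℕ; _≤_; _<_; _*_)
open import Data.Fin using (Fin)
open import Data.Integer as ℤ using (ℤ; +_)
open import Data.Rational as ℚ using (ℚ; 0ℚ)
open import Data.Product using (Σ; _×_)

open import Algebra.Bundles using (CommutativeMonoid)
open import Data.Nat using (zero; suc; _+_; _∸_; z≤n; s≤s)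
import Data.Nat.Properties as ℕP
open import Data.Nat.ListAction using (sum)
open import Data.Nat.ListAction.Properties using (sum-++; sum-↭)
open import Data.Integer using (0ℤ; ∣_∣; -[1+_])
import Data.Integer.Properties as ℤP
open import Data.Fin using (zero; suc)
open import Data.List using (List; []; _∷_; _++_; [_]; length; map; foldr; concat; take; replicate)
import Data.List.Properties as LP
open import Data.List.Relation.Unary.All using (All; []; _∷_)
import Data.List.Relation.Unary.All as All
import Data.List.Relation.Unary.All.Properties as AllP
open import Data.List.Relation.Binary.Permutation.Propositional
  using (_↭_; ↭-refl; ↭-sym; ↭-trans; ↭-reflexive; ↭⇒↭ₛ; prep)
open import Data.List.Relation.Binary.Permutation.Propositional.Properties
  using (map⁺; ++⁺; ++⁺ˡ; ++⁺ʳ; ++-comm; ++-assoc; shift; shifts; All-resp-↭; ↭-length)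
open import Data.List.Relation.Binary.Permutation.Setoid.Properties using (foldr-commMonoid)
open import Data.Product using (_,_; proj₁; proj₂)
open import Data.Sum using (_⊎_; inj₁; inj₂)
open import Data.Empty using (⊥-elim)
open import Relation.Nullary using (¬_; yes; no)
open import Relation.Nullary.Decidable using (toSum)
open import Relation.Binary.PropositionalEquality hiding ([_])
open import Algebra.Properties.CommutativeSemigroup ℕP.+-commutativeSemigroup
  using () renaming (interchange to ℕ-interchange)
open import Algebra.Properties.CommutativeSemigroup ℤP.+-commutativeSemigroup
  using () renaming (interchange to ℤ-interchange)

sumN : {n : ℕ} → (Fin n → ℕ) → ℕ
sumN {zero} f = 0
sumN {suc n} f = f zero + sumN (λ i → f (suc i))

sumN-cong : ∀ {n} {f g : Fin n → ℕ} → (∀ i → f i ≡ g i) → sumN f ≡ sumN g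
sumN-cong {zero} e = refl
sumN-cong {suc n} e = cong₂ _+_ (e zero) (sumN-cong (λ i → e (suc i)))

sumℤ-cong : ∀ {n} {f g : Fin n → ℤ} → (∀ i → f i ≡ g i) → sumℤ f ≡ sumℤ g
sumℤ-cong {zero} e = refl
sumℤ-cong {suc n} e = cong₂ ℤ._+_ (e zero) (sumℤ-cong (λ i → e (suc i)))

sumN-zero : ∀ {n} {f : Fin n → ℕ} → (∀ i → f i ≡ 0) → sumN f ≡ 0
sumN-zero {zero} e = refl
sumN-zero {suc n} e = cong₂ _+_ (e zero) (sumN-zero (λ i → e (suc i)))

sumℤ-zero : ∀ {n} {f : Fin n → ℤ} → (∀ i → f i ≡ 0ℤ) → sumℤ f ≡ 0ℤ
sumℤ-zero {zero} e = refl
sumℤ-zero {suc n} e = cong₂ ℤ._+_ (e zero) (sumℤ-zero (λ i → e (suc i)))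

sumN-+ : ∀ {n} (f g : Fin n → ℕ) → sumN (λ i → f i + g i) ≡ sumN f + sumN g
sumN-+ {zero} f g = refl
sumN-+ {suc n} f g = begin
  (f zero + g zero) + sumN (λ i → f (suc i) + g (suc i))
    ≡⟨ cong (λ t → (f zero + g zero) + t) (sumN-+ (λ i → f (suc i)) (λ i → g (suc i))) ⟩
  (f zero + g zero) + (sumN (λ i → f (suc i)) + sumN (λ i → g (suc i)))
    ≡⟨ ℕ-interchange (f zero) (g zero) _ _ ⟩
  (f zero + sumN (λ i → f (suc i))) + (g zero + sumN (λ i → g (suc i))) ∎
  where open ≡-Reasoning

sumℤ-+ : ∀ {n} (f g : Fin n → ℤ) → sumℤ (λ i → f i ℤ.+ g i) ≡ sumℤ f ℤ.+ sumℤ g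
sumℤ-+ {zero} f g = refl
sumℤ-+ {suc n} f g = begin
  (f zero ℤ.+ g zero) ℤ.+ sumℤ (λ i → f (suc i) ℤ.+ g (suc i))
    ≡⟨ cong (λ t → (f zero ℤ.+ g zero) ℤ.+ t) (sumℤ-+ (λ i → f (suc i)) (λ i → g (suc i))) ⟩
  (f zero ℤ.+ g zero) ℤ.+ (sumℤ (λ i → f (suc i)) ℤ.+ sumℤ (λ i → g (suc i)))
    ≡⟨ ℤ-interchange (f zero) (g zero) _ _ ⟩
  (f zero ℤ.+ sumℤ (λ i → f (suc i))) ℤ.+ (g zero ℤ.+ sumℤ (λ i → g (suc i))) ∎
  where open ≡-Reasoning

sumℤ-pos : ∀ {n} (f : Fin n → ℕ) → sumℤ (λ i → + f i) ≡ + sumN f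
sumℤ-pos {zero} f = refl
sumℤ-pos {suc n} f =
  trans (cong (λ t → + f zero ℤ.+ t) (sumℤ-pos (λ i → f (suc i)))) (sym (ℤP.pos-+ (f zero) _))

sumN-term : ∀ {n} (f : Fin n → ℕ) i → f i ≤ sumN f
sumN-term f zero = ℕP.m≤m+n _ _
sumN-term f (suc i) = ℕP.≤-trans (sumN-term (λ k → f (suc k)) i) (ℕP.m≤n+m _ (f zero))

sumN-mono : ∀ {n} {f g : Fin n → ℕ} → (∀ i → f i ≤ g i) → sumN f ≤ sumN g
sumN-mono {zero} le = z≤n
sumN-mono {suc n} le = ℕP.+-mono-≤ (le zero) (sumN-mono (λ i → le (suc i)))

sumN-squares : ∀ {n} (f : Fin n → ℕ) → sumN (λ i → f i * f i) ≤ sumN f * sumN f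
sumN-squares {zero} f = z≤n
sumN-squares {suc n} f = begin
  x * x + sumN (λ i → f (suc i) * f (suc i)) ≤⟨ ℕP.+-monoʳ-≤ (x * x) (sumN-squares (λ i → f (suc i))) ⟩
  x * x + S * S                               ≤⟨ ℕP.+-monoˡ-≤ (S * S) (ℕP.m≤m+n (x * x) (x * S + S * x)) ⟩
  x * x + (x * S + S * x) + S * S             ≡⟨ square-of-sum x S ⟩
  (x + S) * (x + S)                           ∎
  where
  open ℕP.≤-Reasoning
  x S : ℕ
  x = f zero
  S = sumN (λ i → f (suc i))
  square-of-sum : ∀ a b → a * a + (a * b + b * a) + b * b ≡ (a + b) * (a + b)
  square-of-sum = solve-∀ where open import Data.Nat.Tactic.RingSolver

δ : ∀ {n} → Fin n → Fin n → ℕ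
δ zero zero = 1
δ zero (suc k) = 0
δ (suc j) zero = 0
δ (suc j) (suc k) = δ j k

δ-sym : ∀ {n} (j k : Fin n) → δ j k ≡ δ k j
δ-sym zero zero = refl
δ-sym zero (suc k) = refl
δ-sym (suc j) zero = refl
δ-sym (suc j) (suc k) = δ-sym j k

sumN-δ : ∀ {n} (k : Fin n) (c : Fin n → ℕ) → sumN (λ j → δ j k * c j) ≡ c k
sumN-δ zero c = trans (cong₂ _+_ (ℕP.*-identityˡ (c zero)) (sumN-zero {f = λ j → δ (suc j) zero * c (suc j)} (λ _ → refl)))
                      (ℕP.+-identityʳ (c zero))
sumN-δ (suc k) c = sumN-δ k (λ j → c (suc j))

sumℤ-δ : ∀ {n} (k : Fin n) (x : Fin n → ℤ) → sumℤ (λ j → + δ j k ℤ.* x j) ≡ x k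
sumℤ-δ zero x = trans (cong₂ ℤ._+_ (ℤP.*-identityˡ (x zero)) (sumℤ-zero (λ j → ℤP.*-zeroˡ (x (suc j)))))
                      (ℤP.+-identityʳ (x zero))
sumℤ-δ (suc k) x = trans (cong (ℤ._+ rest) (ℤP.*-zeroˡ (x zero)))
                         (trans (ℤP.+-identityˡ rest) (sumℤ-δ k (λ j → x (suc j))))
  where
  rest : ℤ
  rest = sumℤ (λ j → + δ j k ℤ.* x (suc j))

module _ {A : Set} where

  tot : (A → ℤ) → List A → ℤ
  tot g L = foldr ℤ._+_ 0ℤ (map g L)

  totN : (A → ℕ) → List A → ℕ
  totN h L = sum (map h L)

  tot-++ : ∀ g L L' → tot g (L ++ L') ≡ tot g L ℤ.+ tot g L'
  tot-++ g [] L' = sym (ℤP.+-identityˡ _)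
  tot-++ g (x ∷ L) L' = trans (cong (ℤ._+_ (g x)) (tot-++ g L L')) (sym (ℤP.+-assoc (g x) _ _))

  tot-↭ : ∀ g {L L'} → L ↭ L' → tot g L ≡ tot g L'
  tot-↭ g p = foldr-commMonoid ℤ+.setoid ℤ+.isCommutativeMonoid (↭⇒↭ₛ (map⁺ g p))
    where module ℤ+ = CommutativeMonoid ℤP.+-0-commutativeMonoid

  totN-++ : ∀ h L L' → totN h (L ++ L') ≡ totN h L + totN h L'
  totN-++ h L L' = trans (cong sum (LP.map-++ h L L')) (sum-++ (map h L) (map h L'))

  totN-↭ : ∀ h {L L'} → L ↭ L' → totN h L ≡ totN h L'
  totN-↭ h p = sum-↭ (map⁺ h p)

  tot-cong : ∀ {g g'} {L} → All (λ a → g a ≡ g' a) L → tot g L ≡ tot g' L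
  tot-cong [] = refl
  tot-cong (e ∷ es) = cong₂ ℤ._+_ e (tot-cong es)

  tot-pos : ∀ h L → tot (λ a → + h a) L ≡ + totN h L
  tot-pos h [] = refl
  tot-pos h (x ∷ L) = trans (cong (ℤ._+_ (+ h x)) (tot-pos h L)) (sym (ℤP.pos-+ (h x) _))

  tot-neg : ∀ g L → tot (λ a → ℤ.- g a) L ≡ ℤ.- tot g L
  tot-neg g [] = refl
  tot-neg g (x ∷ L) = trans (cong (ℤ._+_ (ℤ.- g x)) (tot-neg g L)) (sym (ℤP.neg-distrib-+ (g x) _))

  tot-const : ∀ c L → tot (λ _ → c) L ≡ + length L ℤ.* c
  tot-const c [] = sym (ℤP.*-zeroˡ c)
  tot-const c (x ∷ L) = begin
    c ℤ.+ tot (λ _ → c) L     ≡⟨ cong₂ ℤ._+_ (sym (ℤP.*-identityˡ c)) (tot-const c L) ⟩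
    + 1 ℤ.* c ℤ.+ + length L ℤ.* c ≡⟨ sym (ℤP.*-distribʳ-+ c (+ 1) (+ length L)) ⟩
    + suc (length L) ℤ.* c    ∎
    where open ≡-Reasoning

  tot-bound : ∀ g R {L} → All (λ a → ∣ g a ∣ ≤ R) L → ∣ tot g L ∣ ≤ length L * R
  tot-bound g R [] = z≤n
  tot-bound g R {x ∷ L} (b ∷ bs) =
    ℕP.≤-trans (ℤP.∣i+j∣≤∣i∣+∣j∣ (g x) (tot g L)) (ℕP.+-mono-≤ b (tot-bound g R bs))

  totN-lower : ∀ h {L} → All (λ a → 1 ≤ h a) L → length L ≤ totN h L
  totN-lower h [] = z≤n
  totN-lower h (b ∷ bs) = ℕP.+-mono-≤ b (totN-lower h bs)

  totN-upper : ∀ h R {L} → All (λ a → h a ≤ R) L → totN h L ≤ length L * R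
  totN-upper h R [] = z≤n
  totN-upper h R (b ∷ bs) = ℕP.+-mono-≤ b (totN-upper h R bs)

  _⊑_ : List A → List A → Set
  Z ⊑ L = Σ (List A) λ R → Z ++ R ↭ L

  ⊑-trans : ∀ {X Y Z} → X ⊑ Y → Y ⊑ Z → X ⊑ Z
  ⊑-trans {X} (R₁ , p) (R₂ , q) =
    R₁ ++ R₂ , ↭-trans (↭-sym (++-assoc X R₁ R₂)) (↭-trans (++⁺ʳ R₂ p) q)

  ⊑-++ : ∀ {X₁ Y₁ X₂ Y₂} → X₁ ⊑ Y₁ → X₂ ⊑ Y₂ → (X₁ ++ X₂) ⊑ (Y₁ ++ Y₂)
  ⊑-++ {X₁} {Y₁} {X₂} (R₁ , p) (R₂ , q) = R₁ ++ R₂ , ↭-trans regroup (++⁺ p q)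
    where
    regroup : (X₁ ++ X₂) ++ R₁ ++ R₂ ↭ (X₁ ++ R₁) ++ (X₂ ++ R₂)
    regroup = ↭-trans (++-assoc X₁ X₂ (R₁ ++ R₂))
             (↭-trans (++⁺ˡ X₁ (shifts X₂ R₁)) (↭-sym (++-assoc X₁ R₁ (X₂ ++ R₂))))

  take-⊑ : ∀ n L → take n L ⊑ L
  take-⊑ n L = _ , ↭-reflexive (LP.take++drop≡id n L)

  ⊑-All : ∀ {P : A → Set} {Z L} → Z ⊑ L → All P L → All P Z
  ⊑-All {Z = Z} (R , p) a = proj₁ (AllP.++⁻ Z (All-resp-↭ (↭-sym p) a))

  totN-⊑ : ∀ h {Z L} → Z ⊑ L → totN h Z ≤ totN h L
  totN-⊑ h {Z} (R , p) =
    ℕP.≤-trans (ℕP.m≤m+n _ (totN h R)) (ℕP.≤-reflexive (trans (sym (totN-++ h Z R)) (totN-↭ h p)))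

  complement-⊑ : ∀ Z {R L} → Z ++ R ↭ L → R ⊑ L
  complement-⊑ Z {R} p = Z , ↭-trans (++-comm R Z) p

  complement-length : ∀ Z {R L : List A} → Z ++ R ↭ L → length L ≡ length Z + length R
  complement-length Z {R} p = trans (sym (↭-length p)) (LP.length-++ Z)

  complement-tot : ∀ g Z {R L} → Z ++ R ↭ L → tot g L ≡ tot g Z ℤ.+ tot g R
  complement-tot g Z {R} p = trans (sym (tot-↭ g p)) (tot-++ g Z R)

  complement-All : ∀ {P : A → Set} Z {R L} → Z ++ R ↭ L → All P L → All P R
  complement-All Z p a = proj₂ (AllP.++⁻ Z (All-resp-↭ (↭-sym p) a))

  complement-of-zero-sum : ∀ g Z {R L} → Z ++ R ↭ L → tot g Z ≡ 0ℤ → tot g R ≡ tot g L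
  complement-of-zero-sum g Z {R} p Z≡0 =
    sym (trans (complement-tot g Z p) (trans (cong (ℤ._+ tot g R) Z≡0) (ℤP.+-identityˡ (tot g R))))

  complement-total-bound : ∀ (g : A → ℤ) Z {R L} → Z ++ R ↭ L → ∣ tot g Z ∣ ≤ ∣ tot g L ∣ + ∣ tot g R ∣
  complement-total-bound g Z {R} {L} p =
    subst (λ t → ∣ t ∣ ≤ ∣ tot g L ∣ + ∣ tot g R ∣) difference (ℤP.∣i-j∣≤∣i∣+∣j∣ (tot g L) (tot g R))
    where
    cancel : ∀ x y → (x ℤ.+ y) ℤ.- y ≡ x
    cancel = solve-∀ where open import Data.Integer.Tactic.RingSolver
    difference : tot g L ℤ.- tot g R ≡ tot g Z
    difference = trans (cong (ℤ._- tot g R) (complement-tot g Z p)) (cancel (tot g Z) (tot g R))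

  complement-shorter : ∀ Z {R L : List A} → Z ++ R ↭ L → 1 ≤ length Z → length R < length L
  complement-shorter Z {R} p nonempty =
    ℕP.≤-trans (ℕP.+-monoˡ-≤ (length R) nonempty) (ℕP.≤-reflexive (sym (complement-length Z p)))

  separate : ∀ {P Q : A → Set} → ((a : A) → P a ⊎ Q a) → ∀ L →
    Σ (List A) λ Ls → Σ (List A) λ Rs → All P Ls × All Q Rs × (Ls ++ Rs ↭ L)
  separate classify [] = [] , [] , [] , [] , ↭-refl
  separate classify (x ∷ L) with classify x | separate classify L
  ... | inj₁ px | Ls , Rs , ps , qs , p = x ∷ Ls , Rs , px ∷ ps , qs , prep x p
  ... | inj₂ qx | Ls , Rs , ps , qs , p = Ls , x ∷ Rs , ps , qx ∷ qs , ↭-trans (shift x Ls Rs) (prep x p)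

module _ {A : Set} where

  concat-↭ : {Xs Ys : List (List A)} → Xs ↭ Ys → concat Xs ↭ concat Ys
  concat-↭ _↭_.refl = ↭-refl
  concat-↭ (prep X p) = ++⁺ˡ X (concat-↭ p)
  concat-↭ (_↭_.swap X Y p) = ↭-trans (shifts X Y) (++⁺ˡ Y (++⁺ˡ X (concat-↭ p)))
  concat-↭ (_↭_.trans p q) = ↭-trans (concat-↭ p) (concat-↭ q)

  ⊑-concat : {Zs Bs : List (List A)} → Zs ⊑ Bs → concat Zs ⊑ concat Bs
  ⊑-concat {Zs} (Rs , p) = concat Rs , ↭-trans (↭-reflexive (LP.concat-++ Zs Rs)) (concat-↭ p)

  tot-concat : ∀ (g : A → ℤ) Bs → tot g (concat Bs) ≡ tot (tot g) Bs
  tot-concat g [] = refl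
  tot-concat g (B ∷ Bs) = trans (tot-++ g B (concat Bs)) (cong (ℤ._+_ (tot g B)) (tot-concat g Bs))

  length-concat-≤ : ∀ S (Zs : List (List A)) → All (λ Z → length Z ≤ S) Zs → length (concat Zs) ≤ length Zs * S
  length-concat-≤ S [] [] = z≤n
  length-concat-≤ S (Z ∷ Zs) (le ∷ les) =
    ℕP.≤-trans (ℕP.≤-reflexive (LP.length-++ Z)) (ℕP.+-mono-≤ le (length-concat-≤ S Zs les))

pigeonhole : ∀ {A : Set} R k (h : A → ℕ) L → All (λ a → 1 ≤ h a × h a ≤ R) L → R * k < length L →
  Σ ℕ λ v → (1 ≤ v × v ≤ R) × Σ (List A) λ F → F ⊑ L × All (λ a → h a ≡ v) F × k < length F
pigeonhole zero k h (x ∷ L) ((1≤hx , hx≤0) ∷ _) _ = ⊥-elim (ℕP.<⇒≱ 1≤hx hx≤0)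
pigeonhole (suc R) k h L bounds long with separate (λ a → toSum (h a ℕP.≟ suc R)) L
... | Top , Rest , top , notTop , perm with k ℕP.<? length Top
...   | yes k<Top = suc R , (s≤s z≤n , ℕP.≤-refl) , Top , (Rest , perm) , top , k<Top
...   | no k≮Top with pigeonhole R k h Rest restBounds restLong
  where
  restBounds : All (λ a → 1 ≤ h a × h a ≤ R) Rest
  restBounds = All.zipWith (λ { ((1≤h , h≤1+R) , h≢1+R) → 1≤h , ℕP.≤-pred (ℕP.≤∧≢⇒< h≤1+R h≢1+R) })
                           (complement-All Top perm bounds , notTop)
  restLong : R * k < length Rest
  restLong = ℕP.+-cancelˡ-< k (R * k) (length Rest) (begin-strict
    k + R * k                ≡⟨⟩
    suc R * k                <⟨ long ⟩
    length L                 ≡⟨ complement-length Top perm ⟩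
    length Top + length Rest ≤⟨ ℕP.+-monoˡ-≤ (length Rest) (ℕP.≮⇒≥ k≮Top) ⟩
    k + length Rest          ∎)
    where open ℕP.≤-Reasoning
...     | v , (1≤v , v≤R) , F , F⊑Rest , Fv , k<F =
          v , (1≤v , ℕP.m≤n⇒m≤1+n v≤R) , F , ⊑-trans F⊑Rest (complement-⊑ Top perm) , Fv , k<F

sign-split : ∀ x → x ≡ + ∣ x ∣ ⊎ x ≡ ℤ.- + ∣ x ∣
sign-split (+ n) = inj₁ refl
sign-split -[1+ n ] = inj₂ refl

≤-of-distance : ∀ a b B → ∣ + a ℤ.- + b ∣ ≤ B → a ≤ b + B
≤-of-distance a b B d with ℕP.≤-total a b
... | inj₁ a≤b = ℕP.m≤n⇒m≤n+o B a≤b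
... | inj₂ b≤a = begin
  a           ≤⟨ ℕP.m≤n+m∸n a b ⟩
  b + (a ∸ b) ≡⟨ cong (_+_ b) a∸b≡∣a-b∣ ⟩
  b + ∣ + a ℤ.- + b ∣ ≤⟨ ℕP.+-monoʳ-≤ b d ⟩
  b + B       ∎
  where
  open ℕP.≤-Reasoning
  a∸b≡∣a-b∣ : a ∸ b ≡ ∣ + a ℤ.- + b ∣
  a∸b≡∣a-b∣ = sym (trans (cong ∣_∣ (ℤP.m-n≡m⊖n a b))
                   (trans (ℤP.∣m⊖n∣≡∣n⊖m∣ a b) (ℤP.∣⊖∣-≤ b≤a)))

cancel-pair : ∀ {A : Set} (g : A → ℤ) {a b} F G → All (λ x → g x ≡ + a) F → All (λ x → g x ≡ ℤ.- + b) G →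
  b ≤ length F → a ≤ length G →
  tot g (take b F ++ take a G) ≡ 0ℤ × length (take b F ++ take a G) ≡ b + a
cancel-pair g {a} {b} F G Fa Gb b≤F a≤G = total , trans (LP.length-++ (take b F)) (cong₂ _+_ lenF lenG)
  where
  lenF : length (take b F) ≡ b
  lenF = trans (LP.length-take b F) (ℕP.m≤n⇒m⊓n≡m b≤F)
  lenG : length (take a G) ≡ a
  lenG = trans (LP.length-take a G) (ℕP.m≤n⇒m⊓n≡m a≤G)
  cross : ∀ x y → x ℤ.* y ℤ.+ y ℤ.* ℤ.- x ≡ 0ℤ
  cross = solve-∀ where open import Data.Integer.Tactic.RingSolver
  total : tot g (take b F ++ take a G) ≡ 0ℤ
  total = begin
    tot g (take b F ++ take a G)                         ≡⟨ tot-++ g (take b F) (take a G) ⟩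
    tot g (take b F) ℤ.+ tot g (take a G)                ≡⟨ cong₂ ℤ._+_ (tot-cong (⊑-All (take-⊑ b F) Fa))
                                                                         (tot-cong (⊑-All (take-⊑ a G) Gb)) ⟩
    tot (λ _ → + a) (take b F) ℤ.+ tot (λ _ → ℤ.- + b) (take a G)
      ≡⟨ cong₂ ℤ._+_ (tot-const (+ a) (take b F)) (tot-const (ℤ.- + b) (take a G)) ⟩
    + length (take b F) ℤ.* + a ℤ.+ + length (take a G) ℤ.* ℤ.- + b
      ≡⟨ cong₂ (λ x y → + x ℤ.* + a ℤ.+ + y ℤ.* ℤ.- + b) lenF lenG ⟩
    + b ℤ.* + a ℤ.+ + a ℤ.* ℤ.- + b                      ≡⟨ cross (+ b) (+ a) ⟩
    0ℤ                                                    ∎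
    where open ≡-Reasoning

-- The one-dimensional zero-sum threshold for values in [−R, R] with total in [−B, B].
K₁ : ℕ → ℕ → ℕ
K₁ R B = suc (B + R * R * R + R * R)

-- Counting behind K₁: take p positive values in [1, R] summing to sP and n negative
-- values in [−R, −1] summing to −sN, with sP ≤ sN + B.  If n ≤ R² then p ≤ B + R³,
-- so at least K₁ R B values in total force n > R².
long-side : ∀ R B p n sP sN → p ≤ sP → sP ≤ sN + B → sN ≤ n * R → K₁ R B ≤ p + n → R * R < n
long-side R B p n sP sN p≤sP sP≤sN+B sN≤nR long = ℕP.≰⇒> λ n≤R² → ℕP.<⇒≱ long (begin
  p + n                       ≤⟨ ℕP.+-monoʳ-≤ p n≤R² ⟩
  p + R * R                   ≤⟨ ℕP.+-monoˡ-≤ (R * R) (p≤B+R³ n≤R²) ⟩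
  B + R * R * R + R * R       ∎)
  where
  open ℕP.≤-Reasoning
  p≤B+R³ : n ≤ R * R → p ≤ B + R * R * R
  p≤B+R³ n≤R² = begin
    p             ≤⟨ ℕP.≤-trans p≤sP sP≤sN+B ⟩
    sN + B        ≤⟨ ℕP.+-monoˡ-≤ B (ℕP.≤-trans sN≤nR (ℕP.*-monoˡ-≤ R n≤R²)) ⟩
    R * R * R + B ≡⟨ ℕP.+-comm (R * R * R) B ⟩
    B + R * R * R ∎

module _ {A : Set} (g : A → ℤ) where

  IsPositive IsNegative : A → Set
  IsPositive a = g a ≡ + ∣ g a ∣
  IsNegative a = g a ≡ ℤ.- + ∣ g a ∣

  InRange : ℕ → A → Set
  InRange R a = 1 ≤ ∣ g a ∣ × ∣ g a ∣ ≤ R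

  both-signs-long : ∀ R B Ps Ns → All IsPositive Ps → All IsNegative Ns →
    All (InRange R) Ps → All (InRange R) Ns →
    ∣ tot g Ps ℤ.+ tot g Ns ∣ ≤ B → K₁ R B ≤ length Ps + length Ns →
    R * R < length Ps × R * R < length Ns
  both-signs-long R B Ps Ns pos neg rangeP rangeN bounded long =
    long-side R B (length Ns) (length Ps) sN sP
      (totN-lower size (All.map proj₁ rangeN)) sN≤sP+B (totN-upper size R (All.map proj₂ rangeP))
      (ℕP.≤-trans long (ℕP.≤-reflexive (ℕP.+-comm (length Ps) (length Ns)))) ,
    long-side R B (length Ps) (length Ns) sP sN
      (totN-lower size (All.map proj₁ rangeP)) sP≤sN+B (totN-upper size R (All.map proj₂ rangeN)) long
    where
    size : A → ℕ
    size a = ∣ g a ∣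
    sP sN : ℕ
    sP = totN size Ps
    sN = totN size Ns
    positives-total : tot g Ps ≡ + sP
    positives-total = trans (tot-cong pos) (tot-pos size Ps)
    negatives-total : tot g Ns ≡ ℤ.- + sN
    negatives-total = trans (tot-cong neg) (trans (tot-neg (λ a → + size a) Ns) (cong ℤ.-_ (tot-pos size Ns)))
    difference : ∣ + sP ℤ.- + sN ∣ ≤ B
    difference = subst (λ t → ∣ t ∣ ≤ B) (cong₂ ℤ._+_ positives-total negatives-total) bounded
    sP≤sN+B : sP ≤ sN + B
    sP≤sN+B = ≤-of-distance sP sN B difference
    sN≤sP+B : sN ≤ sP + B
    sN≤sP+B = ≤-of-distance sN sP B (subst (_≤ B) (ℤP.∣i-j∣≡∣j-i∣ (+ sP) (+ sN)) difference)

  -- Many positive and many negative values contain a short cancelling sub-multiset: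
  -- some value a occurs more than R times among the positives and some −b more than
  -- R times among the negatives, and b copies of a cancel a copies of −b.
  opposite-signs-cancel : ∀ R Ps Ns → All IsPositive Ps → All IsNegative Ns →
    All (InRange R) Ps → All (InRange R) Ns → R * R < length Ps → R * R < length Ns →
    Σ (List A) λ Z → Z ⊑ (Ps ++ Ns) × 1 ≤ length Z × length Z ≤ R + R × tot g Z ≡ 0ℤ
  opposite-signs-cancel R Ps Ns pos neg rangeP rangeN longP longN
    with pigeonhole R R (λ a → ∣ g a ∣) Ps rangeP longP | pigeonhole R R (λ a → ∣ g a ∣) Ns rangeN longN
  ... | a , (_ , a≤R) , F , F⊑Ps , Fa , R<F | b , (1≤b , b≤R) , G , G⊑Ns , Gb , R<G =
    take b F ++ take a G ,
    ⊑-++ (⊑-trans (take-⊑ b F) F⊑Ps) (⊑-trans (take-⊑ a G) G⊑Ns) ,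
    subst (1 ≤_) (sym length≡b+a) (ℕP.≤-trans 1≤b (ℕP.m≤m+n b a)) ,
    subst (_≤ R + R) (sym length≡b+a) (ℕP.+-mono-≤ b≤R a≤R) ,
    zero-total
    where
    cancelling : tot g (take b F ++ take a G) ≡ 0ℤ × length (take b F ++ take a G) ≡ b + a
    cancelling = cancel-pair g F G
      (All.zipWith (λ (e , e') → trans e (cong +_ e')) (⊑-All F⊑Ps pos , Fa))
      (All.zipWith (λ (e , e') → trans e (cong (λ t → ℤ.- + t) e')) (⊑-All G⊑Ns neg , Gb))
      (ℕP.<⇒≤ (ℕP.≤-<-trans b≤R R<F)) (ℕP.<⇒≤ (ℕP.≤-<-trans a≤R R<G))
    zero-total : tot g (take b F ++ take a G) ≡ 0ℤ
    zero-total = proj₁ cancelling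
    length≡b+a : length (take b F ++ take a G) ≡ b + a
    length≡b+a = proj₂ cancelling

1≤∣∣ : ∀ {x} → ¬ (x ≡ 0ℤ) → 1 ≤ ∣ x ∣
1≤∣∣ {x} x≢0 = ℕP.n≢0⇒n>0 (λ ∣x∣≡0 → x≢0 (ℤP.∣i∣≡0⇒i≡0 ∣x∣≡0))

ZeroSubsum₁ : ∀ {A : Set} → ℕ → (A → ℤ) → List A → Set
ZeroSubsum₁ {A} S g L = Σ (List A) λ Z → Z ⊑ L × 1 ≤ length Z × length Z ≤ S × tot g Z ≡ 0ℤ

-- The one-dimensional lemma for nonzero values: split by sign; both signs occur
-- more than R² times, so opposite-signs-cancel applies.
zero-sum-nonzero : ∀ {A : Set} R B (g : A → ℤ) L → All (λ a → ¬ (g a ≡ 0ℤ)) L → All (λ a → ∣ g a ∣ ≤ R) L →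
  ∣ tot g L ∣ ≤ B → K₁ R B ≤ length L → ZeroSubsum₁ (R + R) g L
zero-sum-nonzero {A} R B g L nonzero bounded total long = by-sign (separate (λ a → sign-split (g a)) L)
  where
  range : All (InRange g R) L
  range = All.zipWith (λ (g≢0 , g≤R) → 1≤∣∣ g≢0 , g≤R) (nonzero , bounded)
  by-sign : (Σ (List A) λ Ps → Σ (List A) λ Ns → All (IsPositive g) Ps × All (IsNegative g) Ns × (Ps ++ Ns ↭ L)) →
    ZeroSubsum₁ (R + R) g L
  by-sign (Ps , Ns , pos , neg , signs) =
    let rangeP : All (InRange g R) Ps
        rangeP = ⊑-All (Ns , signs) range
        rangeN : All (InRange g R) Ns
        rangeN = ⊑-All (complement-⊑ Ps signs) range
        longPN : R * R < length Ps × R * R < length Ns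
        longPN = both-signs-long g R B Ps Ns pos neg rangeP rangeN
                   (subst (λ t → ∣ t ∣ ≤ B) (complement-tot g Ps signs) total)
                   (subst (K₁ R B ≤_) (complement-length Ps signs) long)
        (Z , Z⊑PN , rest) = opposite-signs-cancel g R Ps Ns pos neg rangeP rangeN (proj₁ longPN) (proj₂ longPN)
    in Z , ⊑-trans Z⊑PN ([] , ↭-trans (↭-reflexive (LP.++-identityʳ _)) signs) , rest

zero-sum₁ : ∀ {A : Set} R B (g : A → ℤ) L → All (λ a → ∣ g a ∣ ≤ R) L → ∣ tot g L ∣ ≤ B →
  K₁ R B ≤ length L → ZeroSubsum₁ (suc (R + R)) g L
zero-sum₁ R B g L bounded total long with separate (λ a → toSum (g a ℤP.≟ 0ℤ)) L
... | a ∷ Zeros , Rest , ga≡0 ∷ _ , _ , perm =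
  [ a ] , ⊑-trans (Zeros , ↭-refl) (Rest , perm) , ℕP.≤-refl , s≤s z≤n , cong (λ t → t ℤ.+ 0ℤ) ga≡0
... | [] , Nonzero , [] , nonzero , perm =
  let (Z , Z⊑ , nonempty , short , zero-total) =
        zero-sum-nonzero R B g Nonzero nonzero (complement-All [] perm bounded)
          (subst (λ t → ∣ t ∣ ≤ B) (sym (tot-↭ g perm)) total) (subst (K₁ R B ≤_) (sym (↭-length perm)) long)
  in Z , ⊑-trans Z⊑ (complement-⊑ [] perm) , nonempty , ℕP.m≤n⇒m≤1+n short , zero-total

exhaust : ∀ {A : Set} {P Q : List A → Set} K →
  (∀ L → P L → K ≤ length L →
     Σ (List A) λ W → Σ (List A) λ R → (W ++ R ↭ L) × 1 ≤ length W × Q W × P R) →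
  ∀ L → P L →
  Σ (List (List A)) λ Bs → Σ (List A) λ Rest → (concat Bs ++ Rest ↭ L) × All Q Bs × length Rest < K × P Rest
exhaust {A} {P} {Q} K find L pL = go (suc (length L)) L ℕP.≤-refl pL
  where
  -- recursion on an upper bound n for the length, which each removed block decreases
  go : ∀ n L → length L < n → P L →
    Σ (List (List A)) λ Bs → Σ (List A) λ Rest → (concat Bs ++ Rest ↭ L) × All Q Bs × length Rest < K × P Rest
  go (suc n) L len<n pL with K ℕP.≤? length L
  ... | no short = [] , L , ↭-refl , [] , ℕP.≰⇒> short , pL
  ... | yes long with find L pL long
  ... | W , R , perm , nonempty , qW , pR
    with go n R (ℕP.<-≤-trans (complement-shorter W perm nonempty) (ℕP.≤-pred len<n)) pR
  ... | Bs , Rest , perm' , qBs , short , pRest =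
    W ∷ Bs , Rest , ↭-trans (↭-reflexive (LP.++-assoc W (concat Bs) Rest)) (↭-trans (++⁺ˡ W perm') perm) ,
    qW ∷ qBs , short , pRest

module _ {A : Set} {s : ℕ} where

  Bounded : ℕ → (A → Fin s → ℤ) → A → Set
  Bounded R f a = ∀ i → ∣ f a i ∣ ≤ R

  ZeroSum : (A → Fin s → ℤ) → List A → Set
  ZeroSum f Z = ∀ i → tot (λ a → f a i) Z ≡ 0ℤ

  ShortZeroSum : ℕ → (A → Fin s → ℤ) → List A → Set
  ShortZeroSum S f Z = 1 ≤ length Z × length Z ≤ S × ZeroSum f Z

HasZeroSums : (s R B K S : ℕ) → Set₁
HasZeroSums s R B K S = ∀ {A : Set} (f : A → Fin s → ℤ) L → All (Bounded R f) L →
  (∀ i → ∣ tot (λ a → f a i) L ∣ ≤ B) → K ≤ length L →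
  Σ (List A) λ Z → Z ⊑ L × ShortZeroSum S f Z

module _ {A : Set} {s : ℕ} where

  headᶠ : (A → Fin (suc s) → ℤ) → A → ℤ
  headᶠ f a = f a zero

  tailᶠ : (A → Fin (suc s) → ℤ) → A → Fin s → ℤ
  tailᶠ f a i = f a (suc i)

  glue-blocks : ∀ S T (f : A → Fin (suc s) → ℤ) Zs → All (ShortZeroSum S (tailᶠ f)) Zs →
    1 ≤ length Zs → length Zs ≤ T → tot (tot (headᶠ f)) Zs ≡ 0ℤ → ShortZeroSum (T * S) f (concat Zs)
  glue-blocks S T f Zs@(Z ∷ _) blocks@((1≤Z , _ , _) ∷ _) _ Zs≤T head-zero =
    ℕP.≤-trans 1≤Z (ℕP.≤-trans (ℕP.m≤m+n (length Z) _) (ℕP.≤-reflexive (sym (LP.length-++ Z)))) ,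
    ℕP.≤-trans (length-concat-≤ S Zs (All.map (λ (_ , short , _) → short) blocks)) (ℕP.*-monoˡ-≤ S Zs≤T) ,
    zero-sum
    where
    zero-sum : ZeroSum f (concat Zs)
    zero-sum zero = trans (tot-concat (headᶠ f) Zs) head-zero
    zero-sum (suc i) = begin
      tot (λ a → f a (suc i)) (concat Zs)     ≡⟨ tot-concat (λ a → f a (suc i)) Zs ⟩
      tot (tot (λ a → f a (suc i))) Zs        ≡⟨ tot-cong (All.map (λ (_ , _ , zs) → zs i) blocks) ⟩
      tot (λ _ → 0ℤ) Zs                       ≡⟨ tot-const 0ℤ Zs ⟩
      + length Zs ℤ.* 0ℤ                      ≡⟨ ℤP.*-zeroʳ (+ length Zs) ⟩
      0ℤ                                      ∎
      where open ≡-Reasoning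

many-blocks : ∀ K' S K b r l → K' * S + K ≤ l → l ≤ b * S + r → r < K → K' ≤ b
many-blocks K' S K b r l long l≤bS+r r<K =
  ℕP.<⇒≤ (ℕP.*-cancelʳ-< S K' b (ℕP.+-cancelʳ-< K (K' * S) (b * S) (begin-strict
    K' * S + K ≤⟨ long ⟩
    l          ≤⟨ l≤bS+r ⟩
    b * S + r  <⟨ ℕP.+-monoʳ-< (b * S) r<K ⟩
    b * S + K  ∎)))
  where open ℕP.≤-Reasoning

module _ {s R B K S : ℕ} (zero-sums-s : HasZeroSums s R B K S) {A : Set} (f : A → Fin (suc s) → ℤ) where

  -- The invariant kept while cutting blocks: bounded entries, and last s
  -- coordinates of the total in [−B, B].
  TailBounded : List A → Set
  TailBounded L = All (Bounded R f) L × (∀ i → ∣ tot (λ a → tailᶠ f a i) L ∣ ≤ B)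

  find-tail-block : ∀ L → TailBounded L → K ≤ length L →
    Σ (List A) λ W → Σ (List A) λ R' → (W ++ R' ↭ L) × 1 ≤ length W × ShortZeroSum S (tailᶠ f) W × TailBounded R'
  find-tail-block L (bounded , total) long =
    let (W , (R' , perm) , block) = zero-sums-s (tailᶠ f) L (All.map (λ b i → b (suc i)) bounded) total long
        (nonempty , _ , zero-sum) = block
    in W , R' , perm , nonempty , block , complement-All W perm bounded ,
       λ i → subst (λ t → ∣ t ∣ ≤ B) (sym (complement-of-zero-sum (λ a → tailᶠ f a i) W perm (zero-sum i))) (total i)

  record TailBlocks (L : List A) : Set where
    field
      Bs : List (List A)
      Rest : List A
      perm : concat Bs ++ Rest ↭ L
      blocks : All (ShortZeroSum S (tailᶠ f)) Bs
      short : length Rest < K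
      rest-bounded : All (Bounded R f) Rest

  tail-blocks : ∀ L → TailBounded L → TailBlocks L
  tail-blocks L inv =
    let (Bs , Rest , perm , blocks , short , (rest-bounded , _)) = exhaust K find-tail-block L inv
    in record { Bs = Bs ; Rest = Rest ; perm = perm ; blocks = blocks ; short = short ; rest-bounded = rest-bounded }

-- Cut L greedily into blocks that are short
-- zero-sums in the last s coordinates until fewer than K elements remain.  There
-- are then at least K₁ (S·R) (B + K·R) blocks; the one-dimensional lemma applied to
-- their first-coordinate totals selects blocks whose union is a zero-sum.
dimension-step : ∀ {s R B K S} → HasZeroSums s R B K S →
  HasZeroSums (suc s) R B (K₁ (S * R) (B + K * R) * S + K) (suc (S * R + S * R) * S)
dimension-step {s} {R} {B} {K} {S} zero-sums-s f L bounded total long =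
  let (Zs , Zs⊑Bs , nonempty , few , head-zero) =
        zero-sum₁ (S * R) (B + K * R) (tot (headᶠ f)) Bs block-bounds blocks-total enough-blocks
  in concat Zs , ⊑-trans (⊑-concat Zs⊑Bs) (Rest , perm) ,
     glue-blocks S (suc (S * R + S * R)) f Zs (⊑-All Zs⊑Bs blocks) nonempty few head-zero
  where
  open TailBlocks (tail-blocks zero-sums-s f L (bounded , λ i → total (suc i)))

  -- each block has at most S elements, each with first coordinate in [−R, R]
  block-bounds : All (λ Z → ∣ tot (headᶠ f) Z ∣ ≤ S * R) Bs
  block-bounds = All.zipWith
    (λ (bd , (_ , Z≤S , _)) → ℕP.≤-trans (tot-bound (headᶠ f) R (All.map (λ b → b zero) bd)) (ℕP.*-monoˡ-≤ R Z≤S))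
    (AllP.concat⁻ (⊑-All (Rest , perm) bounded) , blocks)

  -- the blocks together make up L except for the short remainder Rest
  blocks-total : ∣ tot (tot (headᶠ f)) Bs ∣ ≤ B + K * R
  blocks-total = subst (λ t → ∣ t ∣ ≤ B + K * R) (tot-concat (headᶠ f) Bs) (begin
    ∣ tot (headᶠ f) (concat Bs) ∣               ≤⟨ complement-total-bound (headᶠ f) (concat Bs) perm ⟩
    ∣ tot (headᶠ f) L ∣ + ∣ tot (headᶠ f) Rest ∣ ≤⟨ ℕP.+-mono-≤ (total zero)
                                                   (tot-bound (headᶠ f) R (All.map (λ b → b zero) rest-bounded)) ⟩
    B + length Rest * R                          ≤⟨ ℕP.+-monoʳ-≤ B (ℕP.*-monoˡ-≤ R (ℕP.<⇒≤ short)) ⟩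
    B + K * R                                    ∎)
    where open ℕP.≤-Reasoning

  -- all but fewer than K elements of L lie in blocks of at most S elements
  enough-blocks : K₁ (S * R) (B + K * R) ≤ length Bs
  enough-blocks = many-blocks (K₁ (S * R) (B + K * R)) S K (length Bs) (length Rest) (length L) long
    (ℕP.≤-trans (ℕP.≤-reflexive (complement-length (concat Bs) perm))
      (ℕP.+-monoˡ-≤ (length Rest) (length-concat-≤ S Bs (All.map (λ (_ , Z≤S , _) → Z≤S) blocks))))
    short

size : ℕ → ℕ → ℕ
size zero R = 1
size (suc s) R = suc (size s R * R + size s R * R) * size s R

threshold : ℕ → ℕ → ℕ → ℕ
threshold zero R B = 1
threshold (suc s) R B = K₁ (size s R * R) (B + threshold s R B * R) * size s R + threshold s R B

zero-sums : ∀ s R B → HasZeroSums s R B (threshold s R B) (size s R)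
zero-sums zero R B f (x ∷ L) _ _ _ = [ x ] , (L , ↭-refl) , ℕP.≤-refl , ℕP.≤-refl , λ ()
zero-sums (suc s) R B = dimension-step (zero-sums s R B)

normSq-abs : ∀ {n} (v : Fin n → ℤ) → normSq v ≡ + sumN (λ i → ∣ v i ∣ * ∣ v i ∣)
normSq-abs v = trans (sumℤ-cong (λ i → square (v i))) (sumℤ-pos (λ i → ∣ v i ∣ * ∣ v i ∣))
  where
  square : ∀ x → x ℤ.* x ≡ + (∣ x ∣ * ∣ x ∣)
  square (+ n) = sym (ℤP.pos-* n n)
  square -[1+ n ] = refl

coordinate-bound : ∀ {n} (v : Fin n → ℤ) C → normSq v ℤ.≤ + (C * C) → ∀ i → ∣ v i ∣ ≤ C
coordinate-bound v C small i = ℕP.≮⇒≥ λ C<∣vi∣ → ℕP.<⇒≱ (ℕP.*-mono-< C<∣vi∣ C<∣vi∣)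
  (ℕP.≤-trans (sumN-term (λ i → ∣ v i ∣ * ∣ v i ∣) i) (ℤP.drop‿+≤+ (subst (ℤ._≤ + (C * C)) (normSq-abs v) small)))

normSq-ℓ₁ : ∀ {n} (v : Fin n → ℤ) (e : Fin n → ℕ) → (∀ i → ∣ v i ∣ ≤ e i) → normSq v ℤ.≤ + (sumN e * sumN e)
normSq-ℓ₁ v e v≤e = subst (ℤ._≤ + (sumN e * sumN e)) (sym (normSq-abs v))
  (ℤ.+≤+ (ℕP.≤-trans (sumN-mono (λ i → ℕP.*-mono-≤ (v≤e i) (v≤e i))) (sumN-squares e)))

copies : ∀ {A : Set} {n} → (Fin n → A) → (Fin n → ℕ) → List A
copies {n = zero} tag c = []
copies {n = suc n} tag c = replicate (c zero) (tag zero) ++ copies (λ k → tag (suc k)) (λ k → c (suc k))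

totN-copies : ∀ {A : Set} {n} (h : A → ℕ) (tag : Fin n → A) c → totN h (copies tag c) ≡ sumN (λ k → h (tag k) * c k)
totN-copies {n = zero} h tag c = refl
totN-copies {A} {suc n} h tag c = begin
  totN h (replicate (c zero) (tag zero) ++ rest)         ≡⟨ totN-++ h (replicate (c zero) (tag zero)) rest ⟩
  totN h (replicate (c zero) (tag zero)) + totN h rest   ≡⟨ cong₂ _+_ (replicated (c zero))
                                                                    (totN-copies h (λ k → tag (suc k)) (λ k → c (suc k))) ⟩
  h (tag zero) * c zero + sumN (λ k → h (tag (suc k)) * c (suc k)) ∎
  where
  open ≡-Reasoning
  rest : List A
  rest = copies (λ k → tag (suc k)) (λ k → c (suc k))
  replicated : ∀ r → totN h (replicate r (tag zero)) ≡ h (tag zero) * r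
  replicated zero = sym (ℕP.*-zeroʳ (h (tag zero)))
  replicated (suc r) = trans (cong (_+_ (h (tag zero))) (replicated r)) (sym (ℕP.*-suc (h (tag zero)) r))

-- Signed generators: inj₁ j stands for +X_j and inj₂ j for −X_j.
Signed : ℕ → Set
Signed m = Fin m ⊎ Fin m

module Fibres {m s : ℕ} (X : Fin m → Fin s → ℤ) where

  gen : Signed m → Fin s → ℤ
  gen (inj₁ j) = X j
  gen (inj₂ j) i = ℤ.- X j i

  up down : Fin m → Signed m → ℕ
  up j (inj₁ k) = δ j k
  up j (inj₂ k) = 0
  down j (inj₁ k) = 0
  down j (inj₂ k) = δ j k

  net : Fin m → List (Signed m) → ℤ
  net j L = + totN (up j) L ℤ.- + totN (down j) L

  net-single : ∀ j a → net j [ a ] ≡ + up j a ℤ.- + down j a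
  net-single j a = cong₂ (λ p q → + p ℤ.- + q) (ℕP.+-identityʳ (up j a)) (ℕP.+-identityʳ (down j a))

  gen-expansion : ∀ a i → gen a i ≡ sumℤ (λ j → net j [ a ] ℤ.* X j i)
  gen-expansion (inj₁ k) i = sym (trans (sumℤ-cong (λ j → trans (cong (ℤ._* X j i) (net-single j (inj₁ k)))
                                                                (drop-zero (+ δ j k) (X j i))))
                                        (sumℤ-δ k (λ j → X j i)))
    where
    drop-zero : ∀ y x → (y ℤ.- + 0) ℤ.* x ≡ y ℤ.* x
    drop-zero = solve-∀ where open import Data.Integer.Tactic.RingSolver
  gen-expansion (inj₂ k) i = sym (trans (sumℤ-cong (λ j → trans (cong (ℤ._* X j i) (net-single j (inj₂ k)))
                                                                (flip (+ δ j k) (X j i))))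
                                        (sumℤ-δ k (λ j → ℤ.- X j i)))
    where
    flip : ∀ y x → (+ 0 ℤ.- y) ℤ.* x ≡ y ℤ.* ℤ.- x
    flip = solve-∀ where open import Data.Integer.Tactic.RingSolver

  tot-gen : ∀ L i → tot (λ a → gen a i) L ≡ sumℤ (λ j → net j L ℤ.* X j i)
  tot-gen [] i = sym (sumℤ-zero (λ j → ℤP.*-zeroˡ (X j i)))
  tot-gen (a ∷ L) i = begin
    gen a i ℤ.+ tot (λ a → gen a i) L
      ≡⟨ cong₂ ℤ._+_ (gen-expansion a i) (tot-gen L i) ⟩
    sumℤ (λ j → net j [ a ] ℤ.* X j i) ℤ.+ sumℤ (λ j → net j L ℤ.* X j i)
      ≡⟨ sym (sumℤ-+ (λ j → net j [ a ] ℤ.* X j i) (λ j → net j L ℤ.* X j i)) ⟩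
    sumℤ (λ j → net j [ a ] ℤ.* X j i ℤ.+ net j L ℤ.* X j i)
      ≡⟨ sumℤ-cong (λ j → net-cons j) ⟩
    sumℤ (λ j → net j (a ∷ L) ℤ.* X j i) ∎
    where
    open ≡-Reasoning
    combine : ∀ p q r t x → (p ℤ.- q) ℤ.* x ℤ.+ (r ℤ.- t) ℤ.* x ≡ (p ℤ.+ r ℤ.- (q ℤ.+ t)) ℤ.* x
    combine = solve-∀ where open import Data.Integer.Tactic.RingSolver
    net-cons : ∀ j → net j [ a ] ℤ.* X j i ℤ.+ net j L ℤ.* X j i ≡ net j (a ∷ L) ℤ.* X j i
    net-cons j = trans (cong (λ t → t ℤ.* X j i ℤ.+ net j L ℤ.* X j i) (net-single j a))
      (trans (combine (+ up j a) (+ down j a) (+ totN (up j) L) (+ totN (down j) L) (X j i))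
        (cong₂ (λ p q → (p ℤ.- q) ℤ.* X j i) (sym (ℤP.pos-+ (up j a) _)) (sym (ℤP.pos-+ (down j a) _))))

  -- Each signed generator is counted exactly once.
  counts-length : ∀ L → sumN (λ j → totN (up j) L + totN (down j) L) ≡ length L
  counts-length [] = sumN-zero {f = λ j → totN (up j) [] + totN (down j) []} (λ _ → refl)
  counts-length (a ∷ L) = begin
    sumN (λ j → (up j a + totN (up j) L) + (down j a + totN (down j) L))
      ≡⟨ sumN-cong (λ j → ℕ-interchange (up j a) (totN (up j) L) (down j a) (totN (down j) L)) ⟩
    sumN (λ j → (up j a + down j a) + (totN (up j) L + totN (down j) L))
      ≡⟨ sumN-+ (λ j → up j a + down j a) _ ⟩
    sumN (λ j → up j a + down j a) + sumN (λ j → totN (up j) L + totN (down j) L)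
      ≡⟨ cong₂ _+_ (once a) (counts-length L) ⟩
    suc (length L) ∎
    where
    open ≡-Reasoning
    once : ∀ a → sumN (λ j → up j a + down j a) ≡ 1
    once (inj₁ k) = trans (sumN-cong (λ j → trans (ℕP.+-identityʳ (δ j k)) (sym (ℕP.*-identityʳ (δ j k)))))
                          (sumN-δ k (λ _ → 1))
    once (inj₂ k) = trans (sumN-cong (λ j → sym (ℕP.*-identityʳ (δ j k)))) (sumN-δ k (λ _ → 1))

  move : (Fin m → ℕ) → List (Signed m) → Fin m → ℕ
  move u L j = (u j ∸ totN (down j) L) + totN (up j) L

  Fits : (Fin m → ℕ) → List (Signed m) → Set
  Fits u L = ∀ j → totN (down j) L ≤ u j

  move-net : ∀ u L → Fits u L → ∀ j → + move u L j ≡ + u j ℤ.+ net j L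
  move-net u L fits j = begin
    + ((u j ∸ D) + U)         ≡⟨ ℤP.pos-+ (u j ∸ D) U ⟩
    + (u j ∸ D) ℤ.+ + U       ≡⟨ cong (ℤ._+ + U) (sym (trans (ℤP.m-n≡m⊖n (u j) D) (ℤP.⊖-≥ (fits j)))) ⟩
    (+ u j ℤ.- + D) ℤ.+ + U   ≡⟨ regroup (+ u j) (+ D) (+ U) ⟩
    + u j ℤ.+ (+ U ℤ.- + D)   ∎
    where
    open ≡-Reasoning
    D U : ℕ
    D = totN (down j) L
    U = totN (up j) L
    regroup : ∀ x y z → (x ℤ.- y) ℤ.+ z ≡ x ℤ.+ (z ℤ.- y)
    regroup = solve-∀ where open import Data.Integer.Tactic.RingSolver

  move-combo : ∀ u L → Fits u L → ∀ i → combo X (move u L) i ≡ combo X u i ℤ.+ tot (λ a → gen a i) L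
  move-combo u L fits i = begin
    sumℤ (λ j → + move u L j ℤ.* X j i)
      ≡⟨ sumℤ-cong (λ j → trans (cong (ℤ._* X j i) (move-net u L fits j)) (ℤP.*-distribʳ-+ (X j i) (+ u j) (net j L))) ⟩
    sumℤ (λ j → + u j ℤ.* X j i ℤ.+ net j L ℤ.* X j i)
      ≡⟨ sumℤ-+ (λ j → + u j ℤ.* X j i) (λ j → net j L ℤ.* X j i) ⟩
    combo X u i ℤ.+ sumℤ (λ j → net j L ℤ.* X j i)
      ≡⟨ cong (ℤ._+_ (combo X u i)) (sym (tot-gen L i)) ⟩
    combo X u i ℤ.+ tot (λ a → gen a i) L ∎
    where open ≡-Reasoning

  move-distance : ∀ u L → Fits u L → distSq u (move u L) ℤ.≤ + (length L * length L)
  move-distance u L fits = subst (λ n → distSq u (move u L) ℤ.≤ + (n * n)) (counts-length L)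
    (normSq-ℓ₁ (λ j → + u j ℤ.- + move u L j) (λ j → totN (up j) L + totN (down j) L) coordinate)
    where
    cancel : ∀ x y → x ℤ.- (x ℤ.+ y) ≡ ℤ.- y
    cancel = solve-∀ where open import Data.Integer.Tactic.RingSolver
    coordinate : ∀ j → ∣ + u j ℤ.- + move u L j ∣ ≤ totN (up j) L + totN (down j) L
    coordinate j = ℕP.≤-trans
      (ℕP.≤-reflexive (trans (cong (λ t → ∣ + u j ℤ.- t ∣) (move-net u L fits j))
                      (trans (cong ∣_∣ (cancel (+ u j) (net j L))) (ℤP.∣-i∣≡∣i∣ (net j L)))))
      (ℤP.∣i-j∣≤∣i∣+∣j∣ (+ totN (up j) L) (+ totN (down j) L))

  bridge : (Fin m → ℕ) → (Fin m → ℕ) → List (Signed m)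
  bridge u v = copies inj₁ v ++ copies inj₂ u

  private
    select : ∀ (c : Fin m → ℕ) j → sumN (λ k → δ j k * c k) ≡ c j
    select c j = trans (sumN-cong (λ k → cong (_* c k) (δ-sym j k))) (sumN-δ j c)

    none : ∀ (c : Fin m → ℕ) → sumN (λ k → 0 * c k) ≡ 0
    none c = sumN-zero {f = λ k → 0 * c k} (λ _ → refl)

  bridge-up : ∀ u v j → totN (up j) (bridge u v) ≡ v j
  bridge-up u v j = begin
    totN (up j) (copies inj₁ v ++ copies inj₂ u)                ≡⟨ totN-++ (up j) (copies inj₁ v) (copies inj₂ u) ⟩
    totN (up j) (copies inj₁ v) + totN (up j) (copies inj₂ u)   ≡⟨ cong₂ _+_ (trans (totN-copies (up j) inj₁ v) (select v j))
                                                                             (trans (totN-copies (up j) inj₂ u) (none u)) ⟩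
    v j + 0                                                      ≡⟨ ℕP.+-identityʳ (v j) ⟩
    v j                                                          ∎
    where open ≡-Reasoning

  bridge-down : ∀ u v j → totN (down j) (bridge u v) ≡ u j
  bridge-down u v j = begin
    totN (down j) (copies inj₁ v ++ copies inj₂ u)                 ≡⟨ totN-++ (down j) (copies inj₁ v) (copies inj₂ u) ⟩
    totN (down j) (copies inj₁ v) + totN (down j) (copies inj₂ u)  ≡⟨ cong₂ _+_ (trans (totN-copies (down j) inj₁ v) (none v))
                                                                                (trans (totN-copies (down j) inj₂ u) (select u j)) ⟩
    u j                                                             ∎
    where open ≡-Reasoning

  -- Moving u along bridge u v gives v, so the total of the bridge is z' − z.
  bridge-total : ∀ {z z' u v} → InA X z u → InA X z' v → ∀ i → tot (λ a → gen a i) (bridge u v) ≡ z' i ℤ.- z i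
  bridge-total {z} {z'} {u} {v} u∈ v∈ i = solve-for (begin
    z' i                                          ≡⟨ sym (v∈ i) ⟩
    combo X v i                                   ≡⟨ sumℤ-cong (λ j → cong (λ t → + t ℤ.* X j i) (sym (arrives j))) ⟩
    combo X (move u (bridge u v)) i               ≡⟨ move-combo u (bridge u v) fits i ⟩
    combo X u i ℤ.+ tot (λ a → gen a i) (bridge u v) ≡⟨ cong (ℤ._+ _) (u∈ i) ⟩
    z i ℤ.+ tot (λ a → gen a i) (bridge u v)     ∎)
    where
    open ≡-Reasoning
    fits : Fits u (bridge u v)
    fits j = ℕP.≤-reflexive (bridge-down u v j)
    arrives : ∀ j → move u (bridge u v) j ≡ v j
    arrives j = cong₂ _+_ (trans (cong (u j ∸_) (bridge-down u v j)) (ℕP.n∸n≡0 (u j))) (bridge-up u v j)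
    solve-for : ∀ {a b t} → a ≡ b ℤ.+ t → t ≡ a ℤ.- b
    solve-for {a} {b} {t} e = trans (sym (cancel b t)) (cong (ℤ._- b) (sym e))
      where
      cancel : ∀ x y → (x ℤ.+ y) ℤ.- x ≡ y
      cancel = solve-∀ where open import Data.Integer.Tactic.RingSolver

  entry-bound : ℕ
  entry-bound = sumN (λ j → sumN (λ i → ∣ X j i ∣))

  gen-bounded : ∀ a → Bounded entry-bound gen a
  gen-bounded (inj₁ j) i = entry≤ j i
    where
    entry≤ : ∀ j i → ∣ X j i ∣ ≤ entry-bound
    entry≤ j i = ℕP.≤-trans (sumN-term (λ i → ∣ X j i ∣) i) (sumN-term (λ j → sumN (λ i → ∣ X j i ∣)) j)
  gen-bounded (inj₂ j) i = subst (_≤ entry-bound) (sym (ℤP.∣-i∣≡∣i∣ (X j i))) (gen-bounded (inj₁ j) i)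

  shorten : ∀ C (w : Fin s → ℤ) → (∀ i → ∣ w i ∣ ≤ C) → ∀ L → (∀ i → tot (λ a → gen a i) L ≡ w i) →
    Σ (List (Signed m)) λ L' → L' ⊑ L × length L' < threshold s entry-bound C × (∀ i → tot (λ a → gen a i) L' ≡ w i)
  shorten C w w≤C L total =
    let (Bs , Rest , perm , _ , short , rest-total) = exhaust (threshold s entry-bound C) find L total
    in Rest , complement-⊑ (concat Bs) perm , short , rest-total
    where
    find : ∀ L' → (∀ i → tot (λ a → gen a i) L' ≡ w i) → threshold s entry-bound C ≤ length L' →
      Σ (List (Signed m)) λ W → Σ (List (Signed m)) λ R' →
        (W ++ R' ↭ L') × 1 ≤ length W × ZeroSum gen W × (∀ i → tot (λ a → gen a i) R' ≡ w i)
    find L' t long =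
      let (W , (R' , perm) , (nonempty , _ , zero-sum)) =
            zero-sums s entry-bound C gen L' (All.tabulate (λ {a} _ → gen-bounded a))
              (λ i → subst (λ x → ∣ x ∣ ≤ C) (sym (t i)) (w≤C i)) long
      in W , R' , perm , nonempty , zero-sum ,
         λ i → trans (complement-of-zero-sum (λ a → gen a i) W perm (zero-sum i)) (t i)

  -- Every point u of A(z) has a point of A(z') within distance threshold s entry-bound C
  -- when z' ∈ J is close to z: follow a shortened bridge from u towards a point v of A(z').
  near-fibre : ∀ C z z' → (∀ i → ∣ z i ℤ.- z' i ∣ ≤ C) → InJ X z' →
    HalfHausLt X z z' (suc (threshold s entry-bound C))
  near-fibre C z z' close (v , v∈) u u∈ =
    let (L , L⊑bridge , short , total) =
          shorten C (λ i → z' i ℤ.- z i) (λ i → subst (_≤ C) (ℤP.∣i-j∣≡∣j-i∣ (z i) (z' i)) (close i))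
                  (bridge u v) (bridge-total u∈ v∈)
        fits : Fits u L
        fits j = ℕP.≤-trans (totN-⊑ (down j) L⊑bridge) (ℕP.≤-reflexive (bridge-down u v j))
        shorter : length L < suc (threshold s entry-bound C)
        shorter = ℕP.m<n⇒m<1+n short
    in move u L ,
       (λ i → trans (move-combo u L fits i) (trans (cong₂ ℤ._+_ (u∈ i) (total i)) (arrive (z i) (z' i)))) ,
       ℤP.≤-<-trans (move-distance u L fits) (ℤ.+<+ (ℕP.*-mono-< shorter shorter))
    where
    arrive : ∀ x y → x ℤ.+ (y ℤ.- x) ≡ y
    arrive = solve-∀ where open import Data.Integer.Tactic.RingSolver

-- Theorem 3.2.  With R an entry bound for X and K = threshold s R C₀, the Hausdorff
-- distance of A(z) and A(z') is less than K + 1 whenever ‖z − z'‖ ≤ C₀; near-fibre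
-- is applied in both directions.
theorem3p2 : (m s : ℕ) → 2 ≤ m → 1 ≤ s →
    (X : Fin m → Fin s → ℤ) → Spans X →
    Σ (Fin s → ℚ) (λ α → (j : Fin m) → 0ℚ ℚ.< dotℤℚ (X j) α) →
    (C₀ : ℕ) → 1 ≤ C₀ →
    Σ ℕ (λ M → (0 < M) × ((z z' : Fin s → ℤ) → InJ X z → InJ X z' →
    normSq (λ i → z i ℤ.- z' i) ℤ.≤ + (C₀ * C₀) → HausLt X z z' M))
theorem3p2 m s _ _ X _ _ C₀ _ =
  suc (threshold s entry-bound C₀) , s≤s z≤n , λ z z' z∈J z'∈J close →
    let coordinates-close : ∀ i → ∣ z i ℤ.- z' i ∣ ≤ C₀
        coordinates-close = coordinate-bound (λ i → z i ℤ.- z' i) C₀ close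
    in near-fibre C₀ z z' coordinates-close z'∈J ,
       near-fibre C₀ z' z (λ i → subst (_≤ C₀) (ℤP.∣i-j∣≡∣j-i∣ (z i) (z' i)) (coordinates-close i)) z∈J
  where open Fibres X
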